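{- Let $G$ be a graph with $n$ vertices and $m$ edges. Then $EM_2(G)=\alpha_{1,2}-6M_2^1+\frac12M_1^4-\frac52M_1^3+6M_1^2-4m+\Theta_2$.
   Context: All invariants are of $G$. For an edge $e=uv$, $\deg(e)=\deg(u)+\deg(v)-2$, and $EM_2(G)=\sum\deg(e)\deg(f)$ over unordered pairs $\{e,f\}$ of distinct edges sharing a vertex. $M_1^\alpha=\sum_v\deg(v)^\alpha$; $M_2^1=\sum_{uv\in E}\deg(u)\deg(v)$; $\alpha_{1,2}=\sum_{uv\in E}[\deg(u)\deg(v)^2+\deg(u)^2\deg(v)]$; $\Theta_2=\sum\deg(u)\deg(w)$ over subgraphs isomorphic to the path $P_3$ (each counted once), written $uvw$ with middle vertex $v$. -}

module Defs where

open import Data.Bool using (Bool; true; false; if_then_else_; _∧_; _∨_)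
open import Data.Nat using (ℕ; _+_; _*_; _∸_; _^_)
open import Data.Fin using (Fin; _<?_; _≟_)
open import Data.List using (List; map; allFin)
open import Data.Nat.ListAction using (sum)
open import Data.Product using (_×_; _,_)
open import Relation.Nullary.Decidable using (⌊_⌋)
open import Relation.Binary.PropositionalEquality using (_≡_)
open import Data.Integer using (+_)
open import Data.Rational using (ℚ; _/_)

record Graph (n : ℕ) : Set where
  field
    adj    : Fin n → Fin n → Bool
    sym    : ∀ u v → adj u v ≡ adj v u
    irrefl : ∀ v → adj v v ≡ false
open Graph public

Σv : ∀ {n} → (Fin n → ℕ) → ℕ
Σv {n} f = sum (map f (allFin n))

[_] : Bool → ℕ
[ true ]  = 1
[ false ] = 0

_<ᵇ_ : ∀ {n} → Fin n → Fin n → Bool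
u <ᵇ v = ⌊ u <? v ⌋

_==_ : ∀ {n} → Fin n → Fin n → Bool
u == v = ⌊ u ≟ v ⌋

module _ {n : ℕ} (G : Graph n) where

  deg : Fin n → ℕ
  deg v = Σv (λ w → [ adj G v w ])

  -- sum over edges: each edge {u,v} is listed once as (u,v) with u < v
  Σe : (Fin n → Fin n → ℕ) → ℕ
  Σe f = Σv (λ u → Σv (λ v → if (u <ᵇ v) ∧ adj G u v then f u v else 0))

  numEdges : ℕ
  numEdges = Σe (λ _ _ → 1)

  edeg : Fin n → Fin n → ℕ
  edeg u v = deg u + deg v ∸ 2

  M1 : ℕ → ℕ
  M1 α = Σv (λ v → deg v ^ α)

  M2 : ℕ
  M2 = Σe (λ u v → deg u * deg v)

  α12 : ℕ
  α12 = Σe (λ u v → deg u * deg v ^ 2 + deg u ^ 2 * deg v)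

  lexLt : Fin n → Fin n → Fin n → Fin n → Bool
  lexLt a b c d = (a <ᵇ c) ∨ ((a == c) ∧ (b <ᵇ d))

  shareVertex : Fin n → Fin n → Fin n → Fin n → Bool
  shareVertex a b c d = (a == c) ∨ (a == d) ∨ (b == c) ∨ (b == d)

  -- EM_2: over unordered pairs {e,f} of distinct edges sharing a vertex
  -- (each pair counted once, via e <lex f)
  EM2 : ℕ
  EM2 = Σe (λ a b → Σe (λ c d →
          if lexLt a b c d ∧ shareVertex a b c d
          then edeg a b * edeg c d else 0))

  -- Θ_2: over paths u v w (middle vertex v), each P3 subgraph counted once
  -- (the unordered pair of end vertices {u,w} is listed with u < w)
  Θ2 : ℕ
  Θ2 = Σv (λ v → Σv (λ u → Σv (λ w →
          if (u <ᵇ w) ∧ adj G u v ∧ adj G v w then deg u * deg w else 0)))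

ℚ[_] : ℕ → ℚ
ℚ[ k ] = + k / 1

-- Two distinct edges of a simple graph share at most one vertex, so EM₂ = Σ_v Σ_{u<w} ε_v(u)·ε_v(w)
-- and Θ₂ = Σ_v Σ_{u<w} δ_v(u)·δ_v(w), where for a neighbour u of v, ε_v(u) = deg(vu) and
-- δ_v(u) = deg u (both 0 otherwise).  Each inner sum is ((Σa)² − Σa²)/2.  Since
-- deg(vu) = deg v + deg u − 2, Σ ε_v and Σ ε_v² are polynomials in deg v, Σ δ_v and Σ δ_v², and in
-- the difference of the two vertex terms Σ δ_v² cancels.  Summing over v with Σ deg^k = M₁^k,
-- Σ_v Σ δ_v = M₁², Σ_v deg v·Σ δ_v = 2M₂, Σ_v deg² v·Σ δ_v = α₁,₂ and Σ_v deg v = 2m gives twice the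
-- claim:  2·EM₂ + 12·M₂ + 5·M₁³ + 8m = 2·Θ₂ + 2·α₁,₂ + 12·M₁² + M₁⁴.
module Submission where

open import Defs renaming (sym to adj-sym)

module Counting where

  open import Data.Bool using (Bool; true; false; T; _∧_; if_then_else_)
  open import Data.Empty using (⊥-elim)
  open import Data.Fin as Fin using (Fin; zero; suc; _<?_; _≟_)
  open import Data.Fin.Properties using (<-cmp; <-trans; <-asym; <-irrefl)
  open import Data.List using (tabulate; _∷_; [])
  open import Data.List.Properties using (map-tabulate)
  open import Data.Nat using (ℕ; zero; suc; _+_; _*_; _∸_; _≤_)
  import Data.Nat.ListAction as List
  open import Data.Nat.Properties
    using (+-*-semiring; +-comm; +-identityʳ; *-identityˡ; *-identityʳ; *-assoc; m≤m+n; +-mono-≤; m∸n+n≡m; +-cancelʳ-≡)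
  open import Data.Nat.Tactic.RingSolver using (solve-∀; solve)
  open import Algebra.Properties.Semiring.Sum +-*-semiring
    using (sum; sum-cong-≗; ∑-distrib-+; ∑-comm; *-distribˡ-sum; *-distribʳ-sum; sum-remove; sum-replicate-zero)
  open import Function using (_∘_; id)
  open import Relation.Binary.Definitions using (tri<; tri≈; tri>)
  open import Relation.Binary.PropositionalEquality
    using (_≡_; _≢_; refl; sym; trans; cong; cong₂; subst; module ≡-Reasoning)
  open import Relation.Nullary using (¬_; yes; no)
  open import Relation.Nullary.Decidable using (isYes≗does; dec-true; dec-false; toWitness)

  private variable
    n : ℕ

  if-else-0 : ∀ b x → (if b then x else 0) ≡ [ b ] * x
  if-else-0 true  x = sym (+-identityʳ x)
  if-else-0 false x = refl

  []-∧ : ∀ b c → [ b ∧ c ] ≡ [ b ] * [ c ]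
  []-∧ true  c = sym (+-identityʳ [ c ])
  []-∧ false c = refl

  []*-cong : ∀ b {x y} → (b ≡ true → x ≡ y) → [ b ] * x ≡ [ b ] * y
  []*-cong true  x≡y = cong (_+ 0) (x≡y refl)
  []*-cong false x≡y = refl

  <ᵇ-true : {u v : Fin n} → u Fin.< v → (u <ᵇ v) ≡ true
  <ᵇ-true {u = u} {v} u<v = trans (isYes≗does (u <? v)) (dec-true (u <? v) u<v)

  <ᵇ-false : {u v : Fin n} → ¬ u Fin.< v → (u <ᵇ v) ≡ false
  <ᵇ-false {u = u} {v} u≮v = trans (isYes≗does (u <? v)) (dec-false (u <? v) u≮v)

  ==-true : {u v : Fin n} → u ≡ v → (u == v) ≡ true
  ==-true {u = u} {v} u≡v = trans (isYes≗does (u ≟ v)) (dec-true (u ≟ v) u≡v)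

  ==-false : {u v : Fin n} → u ≢ v → (u == v) ≡ false
  ==-false {u = u} {v} u≢v = trans (isYes≗does (u ≟ v)) (dec-false (u ≟ v) u≢v)

  <ᵇ⇒< : {u v : Fin n} → (u <ᵇ v) ≡ true → u Fin.< v
  <ᵇ⇒< e = toWitness (subst T (sym e) _)

  [<]+[>]+[=] : (u w : Fin n) → [ u <ᵇ w ] + [ w <ᵇ u ] + [ u == w ] ≡ 1
  [<]+[>]+[=] u w with <-cmp u w
  ... | tri< u<w u≢w w≮u rewrite <ᵇ-true u<w | <ᵇ-false w≮u | ==-false u≢w = refl
  ... | tri≈ u≮w u≡w w≮u rewrite <ᵇ-false u≮w | <ᵇ-false w≮u | ==-true u≡w = refl
  ... | tri> u≮w u≢w w<u rewrite <ᵇ-false u≮w | <ᵇ-true w<u | ==-false u≢w = refl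

  middle-order : {m p q : Fin n} → m ≢ p → m ≢ q →
    [ p <ᵇ q ] * ([ m <ᵇ p ] * [ m <ᵇ q ]) + [ p <ᵇ m ] * [ m <ᵇ q ] + [ p <ᵇ q ] * ([ p <ᵇ m ] * [ q <ᵇ m ]) ≡ [ p <ᵇ q ]
  middle-order {m = m} {p} {q} m≢p m≢q with p <? q
  ... | yes p<q with <-cmp m p
  ...   | tri< m<p _ p≮m rewrite <ᵇ-true m<p | <ᵇ-false p≮m | <ᵇ-true (<-trans m<p p<q) = refl
  ...   | tri≈ _ m≡p _ = ⊥-elim (m≢p m≡p)
  ...   | tri> m≮p _ p<m rewrite <ᵇ-false m≮p | <ᵇ-true p<m with <-cmp m q
  ...     | tri< m<q _ q≮m rewrite <ᵇ-true m<q | <ᵇ-false q≮m = refl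
  ...     | tri≈ _ m≡q _ = ⊥-elim (m≢q m≡q)
  ...     | tri> m≮q _ q<m rewrite <ᵇ-false m≮q | <ᵇ-true q<m = refl
  middle-order {m = m} {p} {q} m≢p m≢q | no p≮q with p <? m
  ... | yes p<m rewrite <ᵇ-false (λ m<q → p≮q (<-trans p<m m<q)) = refl
  ... | no _ = refl

  Σv≡sum : (f : Fin n → ℕ) → Σv f ≡ sum f
  Σv≡sum {n} f = trans (cong List.sum (map-tabulate id f)) (tabulate-sum f)
    where
    tabulate-sum : ∀ {n} (f : Fin n → ℕ) → List.sum (tabulate f) ≡ sum f
    tabulate-sum {zero}  f = refl
    tabulate-sum {suc n} f = cong (f zero +_) (tabulate-sum (f ∘ suc))

  Σv-cong : {f g : Fin n → ℕ} → (∀ x → f x ≡ g x) → Σv f ≡ Σv g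
  Σv-cong {f = f} {g} f≗g = trans (Σv≡sum f) (trans (sum-cong-≗ f≗g) (sym (Σv≡sum g)))

  Σv-+ : (f g : Fin n → ℕ) → Σv (λ x → f x + g x) ≡ Σv f + Σv g
  Σv-+ f g = trans (Σv≡sum (λ x → f x + g x)) (trans (∑-distrib-+ f g) (sym (cong₂ _+_ (Σv≡sum f) (Σv≡sum g))))

  *-distribˡ-Σv : ∀ c (f : Fin n → ℕ) → c * Σv f ≡ Σv (λ x → c * f x)
  *-distribˡ-Σv c f =
    trans (cong (c *_) (Σv≡sum f)) (trans (*-distribˡ-sum c f) (sym (Σv≡sum (λ x → c * f x))))

  Σv-comm : ∀ {m} (f : Fin n → Fin m → ℕ) → Σv (λ x → Σv (f x)) ≡ Σv (λ y → Σv (λ x → f x y))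
  Σv-comm f = begin
    Σv (λ x → Σv (f x))          ≡⟨ Σv-cong (λ x → Σv≡sum (f x)) ⟩
    Σv (λ x → sum (f x))         ≡⟨ Σv≡sum (λ x → sum (f x)) ⟩
    sum (λ x → sum (f x))        ≡⟨ ∑-comm f ⟩
    sum (λ y → sum (λ x → f x y)) ≡⟨ Σv≡sum (λ y → sum (λ x → f x y)) ⟨
    Σv (λ y → sum (λ x → f x y)) ≡⟨ Σv-cong (λ y → Σv≡sum (λ x → f x y)) ⟨
    Σv (λ y → Σv (λ x → f x y))  ∎
    where open ≡-Reasoning

  ≤Σv : (f : Fin n → ℕ) (a : Fin n) → f a ≤ Σv f
  ≤Σv {suc n} f a = subst (f a ≤_) (sym (trans (Σv≡sum f) (sum-remove f))) (m≤m+n (f a) _)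

  Σv-δ : (a : Fin n) (f : Fin n → ℕ) → Σv (λ x → [ a == x ] * f x) ≡ f a
  Σv-δ a f = trans (Σv≡sum (λ x → [ a == x ] * f x)) (sum-δ a f)
    where
    suc-== : ∀ {n} (a x : Fin n) → [ suc a == suc x ] ≡ [ a == x ]
    suc-== a x with a ≟ x
    ... | yes _ = refl
    ... | no  _ = refl
    sum-δ : ∀ {n} (a : Fin n) (f : Fin n → ℕ) → sum (λ x → [ a == x ] * f x) ≡ f a
    sum-δ {suc n} zero    f =
      trans (cong₂ _+_ (+-identityʳ (f zero)) (sum-replicate-zero n)) (+-identityʳ (f zero))
    sum-δ {suc n} (suc a) f = trans (sum-cong-≗ (λ x → cong (_* f (suc x)) (suc-== a x))) (sum-δ a (f ∘ suc))

  Σv-+₃ : (f g h : Fin n → ℕ) → Σv (λ x → f x + g x + h x) ≡ Σv f + Σv g + Σv h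
  Σv-+₃ f g h = trans (Σv-+ (λ x → f x + g x) h) (cong (_+ Σv h) (Σv-+ f g))

  Σv-+₄ : (f g h k : Fin n → ℕ) →
          Σv (λ x → f x + g x + h x + k x) ≡ Σv f + Σv g + Σv h + Σv k
  Σv-+₄ f g h k = trans (Σv-+ (λ x → f x + g x + h x) k)
    (cong (_+ Σv k) (Σv-+₃ f g h))

  Σv-+₅ : (f g h k l : Fin n → ℕ) →
          Σv (λ x → f x + g x + h x + k x + l x) ≡ Σv f + Σv g + Σv h + Σv k + Σv l
  Σv-+₅ f g h k l = trans (Σv-+ (λ x → f x + g x + h x + k x) l) (cong (_+ Σv l) (Σv-+₄ f g h k))

  Σv-scale : ∀ c (f : Fin n → ℕ) {s} → Σv f ≡ s → Σv (λ x → c * f x) ≡ c * s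
  Σv-scale c f Σf≡s = trans (sym (*-distribˡ-Σv c f)) (cong (c *_) Σf≡s)

  *-distribʳ-Σv : ∀ c (f : Fin n → ℕ) → Σv f * c ≡ Σv (λ x → f x * c)
  *-distribʳ-Σv c f =
    trans (cong (_* c) (Σv≡sum f)) (trans (*-distribʳ-sum c f) (sym (Σv≡sum (λ x → f x * c))))

  Σv²-cong : {f g : Fin n → Fin n → ℕ} → (∀ x y → f x y ≡ g x y) →
             Σv (λ x → Σv (f x)) ≡ Σv (λ x → Σv (g x))
  Σv²-cong f≗g = Σv-cong (λ x → Σv-cong (f≗g x))

  Σv²-+ : (f g : Fin n → Fin n → ℕ) →
          Σv (λ x → Σv (λ y → f x y + g x y)) ≡ Σv (λ x → Σv (f x)) + Σv (λ x → Σv (g x))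
  Σv²-+ f g = trans (Σv-cong (λ x → Σv-+ (f x) (g x))) (Σv-+ (λ x → Σv (f x)) (λ x → Σv (g x)))

  *-distribˡ-Σv² : ∀ c (f : Fin n → Fin n → ℕ) → c * Σv (λ x → Σv (f x)) ≡ Σv (λ x → Σv (λ y → c * f x y))
  *-distribˡ-Σv² c f = trans (*-distribˡ-Σv c (λ x → Σv (f x))) (Σv-cong (λ x → *-distribˡ-Σv c (f x)))

  Σv-*-Σv : (f g : Fin n → ℕ) → Σv f * Σv g ≡ Σv (λ x → Σv (λ y → f x * g y))
  Σv-*-Σv f g = trans (*-distribʳ-Σv (Σv g) f) (Σv-cong (λ x → *-distribˡ-Σv (f x) g))

  Σv²-δ₁ : (a : Fin n) (f : Fin n → Fin n → ℕ) →
           Σv (λ x → Σv (λ y → [ a == x ] * f x y)) ≡ Σv (f a)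
  Σv²-δ₁ a f = trans (Σv-cong (λ x → sym (*-distribˡ-Σv [ a == x ] (f x)))) (Σv-δ a (λ x → Σv (f x)))

  Σv²-δ₂ : (a : Fin n) (f : Fin n → Fin n → ℕ) →
           Σv (λ x → Σv (λ y → [ a == y ] * f x y)) ≡ Σv (λ x → f x a)
  Σv²-δ₂ a f = Σv-cong (λ x → Σv-δ a (f x))

  Σv²-+₃ : (f g h : Fin n → Fin n → ℕ) →
           Σv (λ x → Σv (λ y → f x y + g x y + h x y))
             ≡ Σv (λ x → Σv (f x)) + Σv (λ x → Σv (g x)) + Σv (λ x → Σv (h x))
  Σv²-+₃ f g h = trans (Σv²-+ (λ x y → f x y + g x y) h) (cong (_+ Σv (λ x → Σv (h x))) (Σv²-+ f g))

  Σv³-cong : {f g : Fin n → Fin n → Fin n → ℕ} → (∀ x y z → f x y z ≡ g x y z) →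
             Σv (λ x → Σv (λ y → Σv (f x y))) ≡ Σv (λ x → Σv (λ y → Σv (g x y)))
  Σv³-cong f≗g = Σv-cong (λ x → Σv²-cong (f≗g x))

  Σv³-+₃ : (f g h : Fin n → Fin n → Fin n → ℕ) →
           Σv (λ x → Σv (λ y → Σv (λ z → f x y z + g x y z + h x y z)))
             ≡ Σv (λ x → Σv (λ y → Σv (f x y))) + Σv (λ x → Σv (λ y → Σv (g x y))) + Σv (λ x → Σv (λ y → Σv (h x y)))
  Σv³-+₃ f g h = trans (Σv-cong (λ x → Σv²-+₃ (f x) (g x) (h x)))
    (Σv-+₃ (λ x → Σv (λ y → Σv (f x y))) (λ x → Σv (λ y → Σv (g x y))) (λ x → Σv (λ y → Σv (h x y))))

  pairSum : (Fin n → ℕ) → ℕ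
  pairSum f = Σv (λ u → Σv (λ w → [ u <ᵇ w ] * (f u * f w)))

  Σv-square : (f : Fin n → ℕ) → Σv f * Σv f ≡ 2 * pairSum f + Σv (λ u → f u * f u)
  Σv-square f = begin
    Σv f * Σv f
      ≡⟨ Σv-*-Σv f f ⟩
    Σv (λ u → Σv (λ w → f u * f w))
      ≡⟨ Σv²-cong split ⟩
    Σv (λ u → Σv (λ w → [ u <ᵇ w ] * (f u * f w) + [ w <ᵇ u ] * (f w * f u) + [ u == w ] * (f u * f w)))
      ≡⟨ Σv²-+ (λ u w → [ u <ᵇ w ] * (f u * f w) + [ w <ᵇ u ] * (f w * f u)) (λ u w → [ u == w ] * (f u * f w)) ⟩
    Σv (λ u → Σv (λ w → [ u <ᵇ w ] * (f u * f w) + [ w <ᵇ u ] * (f w * f u))) + Σv (λ u → Σv (λ w → [ u == w ] * (f u * f w)))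
      ≡⟨ cong₂ _+_ (Σv²-+ (λ u w → [ u <ᵇ w ] * (f u * f w)) (λ u w → [ w <ᵇ u ] * (f w * f u)))
                   (Σv-cong (λ u → Σv-δ u (λ w → f u * f w))) ⟩
    pairSum f + Σv (λ u → Σv (λ w → [ w <ᵇ u ] * (f w * f u))) + Σv (λ u → f u * f u)
      ≡⟨ cong (λ t → pairSum f + t + Σv (λ u → f u * f u)) (Σv-comm (λ u w → [ w <ᵇ u ] * (f w * f u))) ⟩
    pairSum f + pairSum f + Σv (λ u → f u * f u)
      ≡⟨ cong (λ t → pairSum f + t + Σv (λ u → f u * f u)) (+-identityʳ (pairSum f)) ⟨
    2 * pairSum f + Σv (λ u → f u * f u) ∎
    where
    open ≡-Reasoning
    weigh : ∀ p q r x y → (p + q + r) * (x * y) ≡ p * (x * y) + q * (y * x) + r * (x * y)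
    weigh = solve-∀
    split : ∀ u w → f u * f w ≡ [ u <ᵇ w ] * (f u * f w) + [ w <ᵇ u ] * (f w * f u) + [ u == w ] * (f u * f w)
    split u w = trans (sym (*-identityˡ (f u * f w)))
      (trans (cong (_* (f u * f w)) (sym ([<]+[>]+[=] u w))) (weigh [ u <ᵇ w ] [ w <ᵇ u ] [ u == w ] (f u) (f w)))

  square-shift : ∀ k c s → k + c ≡ s → k * k + 2 * c * s ≡ s * s + c * c
  square-shift k c _ refl = solve (k ∷ c ∷ [])

  -- Nothing can be subtracted in ℕ, so W = D + R + 4s + 4xs (s = x² + S) is added to both sides;
  -- then every hypothesis is used left to right.
  vertex-identity : ∀ x S T D R X Y →
    T + 2 * x ≡ x * x + S →
    D + 4 * (x * x + S) ≡ x * (x * x) + S * (2 * x) + R + 4 * x →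
    T * T ≡ 2 * X + D →
    S * S ≡ 2 * Y + R →
    2 * X + 6 * (x * S) + 5 * (x * (x * x)) + 4 * x
      ≡ 2 * Y + 2 * (x * x * S) + 4 * S + x * x * (x * x) + 8 * (x * x)
  vertex-identity x S T D R X Y T-lin D-sq T-sq S-sq =
    +-cancelʳ-≡ (D + R + 4 * (x * x + S) + 2 * (2 * x) * (x * x + S)) _ _ (begin
      2 * X + 6 * (x * S) + 5 * (x * (x * x)) + 4 * x + (D + R + 4 * (x * x + S) + 2 * (2 * x) * (x * x + S))
        ≡⟨ solve (x ∷ S ∷ D ∷ R ∷ X ∷ []) ⟩
      (2 * X + D) + 2 * (2 * x) * (x * x + S) + (6 * (x * S) + 5 * (x * (x * x)) + 4 * x + R + 4 * (x * x + S))
        ≡⟨ cong (λ t → t + 2 * (2 * x) * (x * x + S) + (6 * (x * S) + 5 * (x * (x * x)) + 4 * x + R + 4 * (x * x + S))) T-sq ⟨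
      T * T + 2 * (2 * x) * (x * x + S) + (6 * (x * S) + 5 * (x * (x * x)) + 4 * x + R + 4 * (x * x + S))
        ≡⟨ cong (_+ (6 * (x * S) + 5 * (x * (x * x)) + 4 * x + R + 4 * (x * x + S))) (square-shift T (2 * x) (x * x + S) T-lin) ⟩
      (x * x + S) * (x * x + S) + 2 * x * (2 * x) + (6 * (x * S) + 5 * (x * (x * x)) + 4 * x + R + 4 * (x * x + S))
        ≡⟨ solve (x ∷ S ∷ R ∷ []) ⟩
      S * S + (x * (x * x) + S * (2 * x) + R + 4 * x) + (2 * (x * x * S) + 4 * S + x * x * (x * x) + 8 * (x * x) + 2 * (2 * x) * (x * x + S))
        ≡⟨ cong₂ (λ t u → t + u + (2 * (x * x * S) + 4 * S + x * x * (x * x) + 8 * (x * x) + 2 * (2 * x) * (x * x + S))) (sym S-sq) D-sq ⟨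
      (2 * Y + R) + (D + 4 * (x * x + S)) + (2 * (x * x * S) + 4 * S + x * x * (x * x) + 8 * (x * x) + 2 * (2 * x) * (x * x + S))
        ≡⟨ solve (x ∷ S ∷ D ∷ R ∷ Y ∷ []) ⟩
      2 * Y + 2 * (x * x * S) + 4 * S + x * x * (x * x) + 8 * (x * x) + (D + R + 4 * (x * x + S) + 2 * (2 * x) * (x * x + S)) ∎)
    where open ≡-Reasoning

  module _ (G : Graph n) where

    A : Fin n → Fin n → ℕ
    A u v = [ adj G u v ]

    A-sym : ∀ u v → A u v ≡ A v u
    A-sym u v = cong [_] (adj-sym G u v)

    A-split : ∀ u v → A u v ≡ [ u <ᵇ v ] * A u v + [ v <ᵇ u ] * A v u
    A-split u v with <-cmp u v
    ... | tri< u<v _ v≮u rewrite <ᵇ-true u<v | <ᵇ-false v≮u = sym (trans (+-identityʳ _) (+-identityʳ _))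
    ... | tri≈ u≮v refl _ rewrite <ᵇ-false u≮v | irrefl G u = refl
    ... | tri> u≮v _ v<u rewrite <ᵇ-false u≮v | <ᵇ-true v<u = trans (A-sym u v) (sym (+-identityʳ _))

    adj⇒≢ : ∀ {u v} → adj G u v ≡ true → u ≢ v
    adj⇒≢ {u} e refl with trans (sym e) (irrefl G u)
    ... | ()

    Σe≡ΣΣ : (f : Fin n → Fin n → ℕ) → Σe G f ≡ Σv (λ u → Σv (λ v → [ u <ᵇ v ] * (A u v * f u v)))
    Σe≡ΣΣ f = Σv²-cong λ u v → begin
      (if (u <ᵇ v) ∧ adj G u v then f u v else 0) ≡⟨ if-else-0 ((u <ᵇ v) ∧ adj G u v) (f u v) ⟩
      [ (u <ᵇ v) ∧ adj G u v ] * f u v            ≡⟨ cong (_* f u v) ([]-∧ (u <ᵇ v) (adj G u v)) ⟩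
      [ u <ᵇ v ] * A u v * f u v                  ≡⟨ *-assoc [ u <ᵇ v ] (A u v) (f u v) ⟩
      [ u <ᵇ v ] * (A u v * f u v)                ∎
      where open ≡-Reasoning

    Σe-cong : {f g : Fin n → Fin n → ℕ} → (∀ u v → f u v ≡ g u v) → Σe G f ≡ Σe G g
    Σe-cong f≗g = Σv²-cong (λ u v → cong (if (u <ᵇ v) ∧ adj G u v then_else 0) (f≗g u v))

    *-distribˡ-Σe : ∀ c (f : Fin n → Fin n → ℕ) → c * Σe G f ≡ Σe G (λ u v → c * f u v)
    *-distribˡ-Σe c f = begin
      c * Σe G f                                                    ≡⟨ cong (c *_) (Σe≡ΣΣ f) ⟩
      c * Σv (λ u → Σv (λ v → [ u <ᵇ v ] * (A u v * f u v)))       ≡⟨ *-distribˡ-Σv² c (λ u v → [ u <ᵇ v ] * (A u v * f u v)) ⟩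
      Σv (λ u → Σv (λ v → c * ([ u <ᵇ v ] * (A u v * f u v))))     ≡⟨ Σv²-cong (λ u v → move [ u <ᵇ v ] (A u v) (f u v)) ⟩
      Σv (λ u → Σv (λ v → [ u <ᵇ v ] * (A u v * (c * f u v))))     ≡⟨ Σe≡ΣΣ (λ u v → c * f u v) ⟨
      Σe G (λ u v → c * f u v)                                      ∎
      where
      open ≡-Reasoning
      move : ∀ p a x → c * (p * (a * x)) ≡ p * (a * (c * x))
      move p a x = solve (c ∷ p ∷ a ∷ x ∷ [])

    Σv-A≡Σe : (g : Fin n → Fin n → ℕ) →
              Σv (λ u → Σv (λ v → A u v * g u v)) ≡ Σe G (λ u v → g u v + g v u)
    Σv-A≡Σe g = begin
      Σv (λ u → Σv (λ v → A u v * g u v))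
        ≡⟨ Σv²-cong (λ u v → trans (cong (_* g u v) (A-split u v)) (split [ u <ᵇ v ] [ v <ᵇ u ] (A u v) (A v u) (g u v))) ⟩
      Σv (λ u → Σv (λ v → [ u <ᵇ v ] * (A u v * g u v) + [ v <ᵇ u ] * (A v u * g u v)))
        ≡⟨ Σv²-+ (λ u v → [ u <ᵇ v ] * (A u v * g u v)) (λ u v → [ v <ᵇ u ] * (A v u * g u v)) ⟩
      Σv (λ u → Σv (λ v → [ u <ᵇ v ] * (A u v * g u v))) + Σv (λ u → Σv (λ v → [ v <ᵇ u ] * (A v u * g u v)))
        ≡⟨ cong (Σv (λ u → Σv (λ v → [ u <ᵇ v ] * (A u v * g u v))) +_) (Σv-comm (λ u v → [ v <ᵇ u ] * (A v u * g u v))) ⟩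
      Σv (λ u → Σv (λ v → [ u <ᵇ v ] * (A u v * g u v))) + Σv (λ u → Σv (λ v → [ u <ᵇ v ] * (A u v * g v u)))
        ≡⟨ Σv²-+ (λ u v → [ u <ᵇ v ] * (A u v * g u v)) (λ u v → [ u <ᵇ v ] * (A u v * g v u)) ⟨
      Σv (λ u → Σv (λ v → [ u <ᵇ v ] * (A u v * g u v) + [ u <ᵇ v ] * (A u v * g v u)))
        ≡⟨ Σv²-cong (λ u v → join [ u <ᵇ v ] (A u v) (g u v) (g v u)) ⟩
      Σv (λ u → Σv (λ v → [ u <ᵇ v ] * (A u v * (g u v + g v u))))
        ≡⟨ Σe≡ΣΣ (λ u v → g u v + g v u) ⟨
      Σe G (λ u v → g u v + g v u) ∎
      where
      open ≡-Reasoning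
      split : ∀ p q a b x → (p * a + q * b) * x ≡ p * (a * x) + q * (b * x)
      split = solve-∀
      join : ∀ p a x y → p * (a * x) + p * (a * y) ≡ p * (a * (x + y))
      join = solve-∀

    Σv-deg : Σv (deg G) ≡ 2 * numEdges G
    Σv-deg = begin
      Σv (deg G)                           ≡⟨ Σv²-cong (λ u v → *-identityʳ (A u v)) ⟨
      Σv (λ u → Σv (λ v → A u v * 1))      ≡⟨ Σv-A≡Σe (λ _ _ → 1) ⟩
      Σe G (λ _ _ → 2)                     ≡⟨ *-distribˡ-Σe 2 (λ _ _ → 1) ⟨
      2 * numEdges G                       ∎
      where open ≡-Reasoning

    Σv-deg² : Σv (λ v → deg G v * deg G v) ≡ M1 G 2
    Σv-deg² = Σv-cong (λ v → cong (deg G v *_) (sym (*-identityʳ (deg G v))))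

    Σv-deg³ : Σv (λ v → deg G v * (deg G v * deg G v)) ≡ M1 G 3
    Σv-deg³ = Σv-cong (λ v → cong (λ t → deg G v * (deg G v * t)) (sym (*-identityʳ (deg G v))))

    Σv-deg⁴ : Σv (λ v → deg G v * deg G v * (deg G v * deg G v)) ≡ M1 G 4
    Σv-deg⁴ = Σv-cong (λ v → fourth (deg G v))
      where
      fourth : ∀ x → x * x * (x * x) ≡ x * (x * (x * (x * 1)))
      fourth = solve-∀

    nbrDeg nbrEdeg : Fin n → Fin n → ℕ
    nbrDeg  v u = if adj G v u then deg G u    else 0
    nbrEdeg v u = if adj G v u then edeg G v u else 0

    Σv-weighted-nbrDeg : (c : Fin n → ℕ) →
      Σv (λ v → c v * Σv (nbrDeg v)) ≡ Σe G (λ u v → c u * deg G v + c v * deg G u)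
    Σv-weighted-nbrDeg c = begin
      Σv (λ v → c v * Σv (nbrDeg v))                  ≡⟨ Σv-cong (λ v → *-distribˡ-Σv (c v) (nbrDeg v)) ⟩
      Σv (λ v → Σv (λ u → c v * nbrDeg v u))          ≡⟨ Σv²-cong weigh ⟩
      Σv (λ v → Σv (λ u → A v u * (c v * deg G u)))   ≡⟨ Σv-A≡Σe (λ v u → c v * deg G u) ⟩
      Σe G (λ u v → c u * deg G v + c v * deg G u)    ∎
      where
      open ≡-Reasoning
      weigh : ∀ v u → c v * nbrDeg v u ≡ A v u * (c v * deg G u)
      weigh v u = trans (cong (c v *_) (if-else-0 (adj G v u) (deg G u)))
                        (swap (c v) (A v u) (deg G u))
        where
        swap : ∀ x a y → x * (a * y) ≡ a * (x * y)
        swap = solve-∀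

    Σv-nbrDeg : Σv (λ v → Σv (nbrDeg v)) ≡ M1 G 2
    Σv-nbrDeg = begin
      Σv (λ v → Σv (nbrDeg v))                ≡⟨ Σv-comm nbrDeg ⟩
      Σv (λ u → Σv (λ v → nbrDeg v u))
        ≡⟨ Σv²-cong (λ u v → trans (if-else-0 (adj G v u) (deg G u)) (cong (_* deg G u) (A-sym v u))) ⟩
      Σv (λ u → Σv (λ v → A u v * deg G u))   ≡⟨ Σv-cong (λ u → *-distribʳ-Σv (deg G u) (A u)) ⟨
      Σv (λ u → deg G u * deg G u)            ≡⟨ Σv-deg² ⟩
      M1 G 2                                  ∎
      where open ≡-Reasoning

    Σv-deg*nbrDeg : Σv (λ v → deg G v * Σv (nbrDeg v)) ≡ 2 * M2 G
    Σv-deg*nbrDeg = trans (Σv-weighted-nbrDeg (deg G))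
      (trans (Σe-cong (λ u v → twice (deg G u) (deg G v))) (sym (*-distribˡ-Σe 2 (λ u v → deg G u * deg G v))))
      where
      twice : ∀ x y → x * y + y * x ≡ 2 * (x * y)
      twice = solve-∀

    Σv-deg²*nbrDeg : Σv (λ v → deg G v * deg G v * Σv (nbrDeg v)) ≡ α12 G
    Σv-deg²*nbrDeg = trans (Σv-weighted-nbrDeg (λ v → deg G v * deg G v))
      (Σe-cong (λ u v → expand (deg G u) (deg G v)))
      where
      expand : ∀ x y → x * x * y + y * y * x ≡ x * (y * (y * 1)) + x * (x * 1) * y
      expand = solve-∀

    ≤-deg : ∀ {v u} → adj G v u ≡ true → 1 ≤ deg G v
    ≤-deg {v} {u} e = subst (_≤ deg G v) (cong [_] e) (≤Σv (A v) u)

    edeg+2 : ∀ {v u} → adj G v u ≡ true → edeg G v u + 2 ≡ deg G v + deg G u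
    edeg+2 {v} {u} e = m∸n+n≡m (+-mono-≤ (≤-deg e) (≤-deg (trans (adj-sym G u v) e)))

    edeg-sym : ∀ u v → edeg G u v ≡ edeg G v u
    edeg-sym u v = cong (_∸ 2) (+-comm (deg G u) (deg G v))

    nbrEdeg-linear : ∀ v u → nbrEdeg v u + 2 * A v u ≡ A v u * deg G v + nbrDeg v u
    nbrEdeg-linear v u with adj G v u in e
    ... | true  = trans (edeg+2 e) (cong (_+ deg G u) (sym (+-identityʳ (deg G v))))
    ... | false = refl

    nbrEdeg-square : ∀ v u →
      nbrEdeg v u * nbrEdeg v u + 4 * (A v u * deg G v + nbrDeg v u)
        ≡ A v u * (deg G v * deg G v) + nbrDeg v u * (2 * deg G v) + nbrDeg v u * nbrDeg v u + 4 * A v u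
    nbrEdeg-square v u with adj G v u in e
    ... | false = refl
    ... | true  = begin
      k * k + 4 * (1 * x + y)   ≡⟨ cong (λ t → k * k + 4 * (t + y)) (*-identityˡ x) ⟩
      k * k + 4 * (x + y)       ≡⟨ square-shift k 2 (x + y) (edeg+2 e) ⟩
      (x + y) * (x + y) + 4     ≡⟨ cong (_+ 4) (expand x y) ⟩
      1 * (x * x) + y * (2 * x) + y * y + 4 ∎
      where
      open ≡-Reasoning
      k = edeg G v u
      x = deg G v
      y = deg G u
      expand : ∀ x y → (x + y) * (x + y) ≡ 1 * (x * x) + y * (2 * x) + y * y
      expand = solve-∀

    Σv-nbrEdeg : ∀ v → Σv (nbrEdeg v) + 2 * deg G v ≡ deg G v * deg G v + Σv (nbrDeg v)
    Σv-nbrEdeg v = begin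
      Σv (nbrEdeg v) + 2 * deg G v                         ≡⟨ cong (Σv (nbrEdeg v) +_) (*-distribˡ-Σv 2 (A v)) ⟩
      Σv (nbrEdeg v) + Σv (λ u → 2 * A v u)                ≡⟨ Σv-+ (nbrEdeg v) (λ u → 2 * A v u) ⟨
      Σv (λ u → nbrEdeg v u + 2 * A v u)                   ≡⟨ Σv-cong (nbrEdeg-linear v) ⟩
      Σv (λ u → A v u * deg G v + nbrDeg v u)              ≡⟨ Σv-+ (λ u → A v u * deg G v) (nbrDeg v) ⟩
      Σv (λ u → A v u * deg G v) + Σv (nbrDeg v)           ≡⟨ cong (_+ Σv (nbrDeg v)) (*-distribʳ-Σv (deg G v) (A v)) ⟨
      deg G v * deg G v + Σv (nbrDeg v)                    ∎
      where open ≡-Reasoning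

    Σv-nbrEdeg² : ∀ v →
      Σv (λ u → nbrEdeg v u * nbrEdeg v u) + 4 * (deg G v * deg G v + Σv (nbrDeg v))
        ≡ deg G v * (deg G v * deg G v) + Σv (nbrDeg v) * (2 * deg G v) + Σv (λ u → nbrDeg v u * nbrDeg v u) + 4 * deg G v
    Σv-nbrEdeg² v = begin
      D + 4 * (x * x + S)
        ≡⟨ cong (λ t → D + 4 * (t + S)) (*-distribʳ-Σv x (A v)) ⟩
      D + 4 * (Σv (λ u → A v u * x) + S)
        ≡⟨ cong (λ t → D + 4 * t) (Σv-+ (λ u → A v u * x) (nbrDeg v)) ⟨
      D + 4 * Σv (λ u → A v u * x + nbrDeg v u)
        ≡⟨ cong (D +_) (*-distribˡ-Σv 4 (λ u → A v u * x + nbrDeg v u)) ⟩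
      D + Σv (λ u → 4 * (A v u * x + nbrDeg v u))
        ≡⟨ Σv-+ (λ u → nbrEdeg v u * nbrEdeg v u) (λ u → 4 * (A v u * x + nbrDeg v u)) ⟨
      Σv (λ u → nbrEdeg v u * nbrEdeg v u + 4 * (A v u * x + nbrDeg v u))
        ≡⟨ Σv-cong (nbrEdeg-square v) ⟩
      Σv (λ u → A v u * (x * x) + nbrDeg v u * (2 * x) + nbrDeg v u * nbrDeg v u + 4 * A v u)
        ≡⟨ Σv-+₄ (λ u → A v u * (x * x)) (λ u → nbrDeg v u * (2 * x)) (λ u → nbrDeg v u * nbrDeg v u) (λ u → 4 * A v u) ⟩
      Σv (λ u → A v u * (x * x)) + Σv (λ u → nbrDeg v u * (2 * x)) + R + Σv (λ u → 4 * A v u)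
        ≡⟨ cong₂ (λ s t → s + t + R + Σv (λ u → 4 * A v u)) (*-distribʳ-Σv (x * x) (A v)) (*-distribʳ-Σv (2 * x) (nbrDeg v)) ⟨
      x * (x * x) + S * (2 * x) + R + Σv (λ u → 4 * A v u)
        ≡⟨ cong (x * (x * x) + S * (2 * x) + R +_) (*-distribˡ-Σv 4 (A v)) ⟨
      x * (x * x) + S * (2 * x) + R + 4 * x ∎
      where
      open ≡-Reasoning
      x = deg G v
      S = Σv (nbrDeg v)
      D = Σv (λ u → nbrEdeg v u * nbrEdeg v u)
      R = Σv (λ u → nbrDeg v u * nbrDeg v u)

    vertex-identity-at : ∀ v →
      2 * pairSum (nbrEdeg v) + 6 * (deg G v * Σv (nbrDeg v)) + 5 * (deg G v * (deg G v * deg G v)) + 4 * deg G v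
        ≡ 2 * pairSum (nbrDeg v) + 2 * (deg G v * deg G v * Σv (nbrDeg v)) + 4 * Σv (nbrDeg v)
          + deg G v * deg G v * (deg G v * deg G v) + 8 * (deg G v * deg G v)
    vertex-identity-at v =
      vertex-identity (deg G v) (Σv (nbrDeg v)) (Σv (nbrEdeg v))
        (Σv (λ u → nbrEdeg v u * nbrEdeg v u)) (Σv (λ u → nbrDeg v u * nbrDeg v u))
        (pairSum (nbrEdeg v)) (pairSum (nbrDeg v))
        (Σv-nbrEdeg v) (Σv-nbrEdeg² v) (Σv-square (nbrEdeg v)) (Σv-square (nbrDeg v))

    Θ2≡Σv-pairSum : Θ2 G ≡ Σv (λ v → pairSum (nbrDeg v))
    Θ2≡Σv-pairSum = Σv³-cong λ v u w → begin
      (if (u <ᵇ w) ∧ adj G u v ∧ adj G v w then deg G u * deg G w else 0)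
        ≡⟨ if-else-0 ((u <ᵇ w) ∧ adj G u v ∧ adj G v w) (deg G u * deg G w) ⟩
      [ (u <ᵇ w) ∧ adj G u v ∧ adj G v w ] * (deg G u * deg G w)
        ≡⟨ cong (_* (deg G u * deg G w)) (trans ([]-∧ (u <ᵇ w) _) (cong ([ u <ᵇ w ] *_) ([]-∧ (adj G u v) (adj G v w)))) ⟩
      [ u <ᵇ w ] * (A u v * A v w) * (deg G u * deg G w)
        ≡⟨ cong (λ t → [ u <ᵇ w ] * (t * A v w) * (deg G u * deg G w)) (A-sym u v) ⟩
      [ u <ᵇ w ] * (A v u * A v w) * (deg G u * deg G w)
        ≡⟨ regroup [ u <ᵇ w ] (A v u) (A v w) (deg G u) (deg G w) ⟩
      [ u <ᵇ w ] * (A v u * deg G u * (A v w * deg G w))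
        ≡⟨ cong₂ (λ s t → [ u <ᵇ w ] * (s * t)) (if-else-0 (adj G v u) (deg G u)) (if-else-0 (adj G v w) (deg G w)) ⟨
      [ u <ᵇ w ] * (nbrDeg v u * nbrDeg v w) ∎
      where
      open ≡-Reasoning
      regroup : ∀ p a b x y → p * (a * b) * (x * y) ≡ p * (a * x * (b * y))
      regroup = solve-∀

    lex∧share : {a b c d : Fin n} → a Fin.< b → c Fin.< d →
      [ lexLt G a b c d ∧ shareVertex G a b c d ] ≡ [ a == c ] * [ b <ᵇ d ] + [ b == c ] + [ b == d ] * [ a <ᵇ c ]
    lex∧share {a} {b} {c} {d} a<b c<d with <-cmp a c
    ... | tri< a<c a≢c _
      rewrite <ᵇ-true a<c | ==-false a≢c | ==-false {u = a} {d} (λ { refl → <-asym a<c c<d })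
      with b ≟ c
    ...   | yes refl rewrite ==-false {u = b} {d} (λ { refl → <-irrefl refl c<d }) = refl
    ...   | no _ with b == d
    ...     | true = refl
    ...     | false = refl
    lex∧share {a} {b} {c} {d} a<b c<d | tri≈ a≮c refl _
      rewrite <ᵇ-false a≮c | ==-true {u = a} refl | ==-false {u = b} {a} (λ { refl → <-irrefl refl a<b })
      with b <ᵇ d | b == d
    ... | true | true = refl
    ... | true | false = refl
    ... | false | true = refl
    ... | false | false = refl
    lex∧share {a} {b} {c} {d} a<b c<d | tri> a≮c a≢c c<a
      rewrite <ᵇ-false a≮c | ==-false a≢c | ==-false {u = b} {c} (λ { refl → <-asym a<b c<a })
      with b <ᵇ d | b == d
    ... | true | true = refl
    ... | true | false = refl
    ... | false | true = refl
    ... | false | false = refl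

    Σe-sharing : ∀ {a b} → a Fin.< b →
      Σe G (λ c d → if lexLt G a b c d ∧ shareVertex G a b c d then edeg G a b * edeg G c d else 0)
        ≡ Σv (λ d → [ a <ᵇ d ] * ([ b <ᵇ d ] * (A a d * (edeg G a b * edeg G a d))))
        + Σv (λ d → [ b <ᵇ d ] * (A b d * (edeg G a b * edeg G b d)))
        + Σv (λ c → [ a <ᵇ c ] * ([ c <ᵇ b ] * (A c b * (edeg G a b * edeg G c b))))
    Σe-sharing {a} {b} a<b = begin
      Σe G (λ c d → if L c d then P c d else 0)
        ≡⟨ Σe≡ΣΣ (λ c d → if L c d then P c d else 0) ⟩
      Σv (λ c → Σv (λ d → [ c <ᵇ d ] * (A c d * (if L c d then P c d else 0))))
        ≡⟨ Σv²-cong classify ⟩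
      Σv (λ c → Σv (λ d → [ a == c ] * F₁ c d + [ b == c ] * F₂ c d + [ b == d ] * F₃ c d))
        ≡⟨ Σv²-+₃ (λ c d → [ a == c ] * F₁ c d) (λ c d → [ b == c ] * F₂ c d) (λ c d → [ b == d ] * F₃ c d) ⟩
      Σv (λ c → Σv (λ d → [ a == c ] * F₁ c d)) + Σv (λ c → Σv (λ d → [ b == c ] * F₂ c d))
        + Σv (λ c → Σv (λ d → [ b == d ] * F₃ c d))
        ≡⟨ cong₂ _+_ (cong₂ _+_ (Σv²-δ₁ a F₁) (Σv²-δ₁ b F₂)) (Σv²-δ₂ b F₃) ⟩
      Σv (F₁ a) + Σv (F₂ b) + Σv (λ c → F₃ c b) ∎
      where
      open ≡-Reasoning
      L : Fin n → Fin n → Bool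
      L c d = lexLt G a b c d ∧ shareVertex G a b c d
      P F₁ F₂ F₃ : Fin n → Fin n → ℕ
      P c d = edeg G a b * edeg G c d
      F₁ c d = [ c <ᵇ d ] * ([ b <ᵇ d ] * (A c d * P c d))
      F₂ c d = [ c <ᵇ d ] * (A c d * P c d)
      F₃ c d = [ a <ᵇ c ] * ([ c <ᵇ d ] * (A c d * P c d))
      swap : ∀ t x l p → t * (x * (l * p)) ≡ t * (l * (x * p))
      swap = solve-∀
      spread : ∀ t e₁ β e₂ e₃ α q →
        t * ((e₁ * β + e₂ + e₃ * α) * q) ≡ e₁ * (t * (β * q)) + e₂ * (t * q) + e₃ * (α * (t * q))
      spread = solve-∀
      classify : ∀ c d → [ c <ᵇ d ] * (A c d * (if L c d then P c d else 0))
                         ≡ [ a == c ] * F₁ c d + [ b == c ] * F₂ c d + [ b == d ] * F₃ c d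
      classify c d = begin
        [ c <ᵇ d ] * (A c d * (if L c d then P c d else 0))
          ≡⟨ cong (λ t → [ c <ᵇ d ] * (A c d * t)) (if-else-0 (L c d) (P c d)) ⟩
        [ c <ᵇ d ] * (A c d * ([ L c d ] * P c d))
          ≡⟨ swap [ c <ᵇ d ] (A c d) [ L c d ] (P c d) ⟩
        [ c <ᵇ d ] * ([ L c d ] * (A c d * P c d))
          ≡⟨ []*-cong (c <ᵇ d) (λ e → cong (_* (A c d * P c d)) (lex∧share a<b (<ᵇ⇒< e))) ⟩
        [ c <ᵇ d ] * (([ a == c ] * [ b <ᵇ d ] + [ b == c ] + [ b == d ] * [ a <ᵇ c ]) * (A c d * P c d))
          ≡⟨ spread [ c <ᵇ d ] [ a == c ] [ b <ᵇ d ] [ b == c ] [ b == d ] [ a <ᵇ c ] (A c d * P c d) ⟩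
        [ a == c ] * F₁ c d + [ b == c ] * F₂ c d + [ b == d ] * F₃ c d ∎

    -- The three summands are the contributions of Σe-sharing for the edges mp, mq (p < q) when m is
    -- the least, the middle and the largest of the three endpoints.
    middle-weights : ∀ m p q →
        [ m <ᵇ p ] * (A m p * ([ m <ᵇ q ] * ([ p <ᵇ q ] * (A m q * (edeg G m p * edeg G m q)))))
      + [ p <ᵇ m ] * (A p m * ([ m <ᵇ q ] * (A m q * (edeg G p m * edeg G m q))))
      + [ p <ᵇ m ] * (A p m * ([ p <ᵇ q ] * ([ q <ᵇ m ] * (A q m * (edeg G p m * edeg G q m)))))
        ≡ [ p <ᵇ q ] * (nbrEdeg m p * nbrEdeg m q)
    middle-weights m p q
      rewrite adj-sym G p m | adj-sym G q m | edeg-sym p m | edeg-sym q m = begin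
        [ m <ᵇ p ] * (A m p * ([ m <ᵇ q ] * ([ p <ᵇ q ] * (A m q * Q))))
          + [ p <ᵇ m ] * (A m p * ([ m <ᵇ q ] * (A m q * Q)))
          + [ p <ᵇ m ] * (A m p * ([ p <ᵇ q ] * ([ q <ᵇ m ] * (A m q * Q))))
        ≡⟨ gather [ m <ᵇ p ] [ m <ᵇ q ] [ p <ᵇ q ] [ p <ᵇ m ] [ q <ᵇ m ] (A m p) (A m q) Q ⟩
        A m p * (A m q * ([ p <ᵇ q ] * ([ m <ᵇ p ] * [ m <ᵇ q ]) + [ p <ᵇ m ] * [ m <ᵇ q ]
                           + [ p <ᵇ q ] * ([ p <ᵇ m ] * [ q <ᵇ m ]))) * Q
        ≡⟨ cong (_* Q) ([]*-cong (adj G m p) λ e → []*-cong (adj G m q) λ e′ →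
                          middle-order (adj⇒≢ e) (adj⇒≢ e′)) ⟩
        A m p * (A m q * [ p <ᵇ q ]) * Q
        ≡⟨ scatter (A m p) (A m q) [ p <ᵇ q ] (edeg G m p) (edeg G m q) ⟩
        [ p <ᵇ q ] * (A m p * edeg G m p * (A m q * edeg G m q))
        ≡⟨ cong₂ (λ s t → [ p <ᵇ q ] * (s * t)) (if-else-0 (adj G m p) (edeg G m p)) (if-else-0 (adj G m q) (edeg G m q)) ⟨
        [ p <ᵇ q ] * (nbrEdeg m p * nbrEdeg m q) ∎
      where
      open ≡-Reasoning
      Q = edeg G m p * edeg G m q
      gather : ∀ a b c d e x y q →
        a * (x * (b * (c * (y * q)))) + d * (x * (b * (y * q))) + d * (x * (c * (e * (y * q))))
          ≡ x * (y * (c * (a * b) + d * b + c * (d * e))) * q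
      gather = solve-∀
      scatter : ∀ x y c k l → x * (y * c) * (k * l) ≡ c * (x * k * (y * l))
      scatter = solve-∀

    EM2≡Σv-pairSum : EM2 G ≡ Σv (λ m → pairSum (nbrEdeg m))
    EM2≡Σv-pairSum = begin
      EM2 G
        ≡⟨ Σe≡ΣΣ sharing ⟩
      Σv (λ a → Σv (λ b → [ a <ᵇ b ] * (A a b * sharing a b)))
        ≡⟨ Σv²-cong (λ a b → []*-cong (a <ᵇ b) (λ e → cong (A a b *_) (Σe-sharing (<ᵇ⇒< e)))) ⟩
      Σv (λ a → Σv (λ b → [ a <ᵇ b ] * (A a b * (Σv (I₁ a b) + Σv (I₂ a b) + Σv (I₃ a b)))))
        ≡⟨ Σv²-cong (λ a b → distribute a b) ⟩
      Σv (λ a → Σv (λ b → Σv (W₁ a b) + Σv (W₂ a b) + Σv (W₃ a b)))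
        ≡⟨ Σv²-+₃ (λ a b → Σv (W₁ a b)) (λ a b → Σv (W₂ a b)) (λ a b → Σv (W₃ a b)) ⟩
      Σv (λ a → Σv (λ b → Σv (W₁ a b))) + Σv (λ a → Σv (λ b → Σv (W₂ a b))) + Σv (λ a → Σv (λ b → Σv (W₃ a b)))
        ≡⟨ cong₂ _+_ (cong (Σv (λ a → Σv (λ b → Σv (W₁ a b))) +_) (Σv-comm (λ a b → Σv (W₂ a b))))
                     (Σv-comm (λ a b → Σv (W₃ a b))) ⟩
      Σv (λ m → Σv (λ p → Σv (W₁ m p))) + Σv (λ m → Σv (λ p → Σv (W₂ p m))) + Σv (λ m → Σv (λ p → Σv (W₃ p m)))
        ≡⟨ Σv³-+₃ W₁ (λ m p → W₂ p m) (λ m p → W₃ p m) ⟨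
      Σv (λ m → Σv (λ p → Σv (λ q → W₁ m p q + W₂ p m q + W₃ p m q)))
        ≡⟨ Σv³-cong middle-weights ⟩
      Σv (λ m → pairSum (nbrEdeg m)) ∎
      where
      open ≡-Reasoning
      sharing : Fin n → Fin n → ℕ
      sharing a b = Σe G (λ c d → if lexLt G a b c d ∧ shareVertex G a b c d then edeg G a b * edeg G c d else 0)
      I₁ I₂ I₃ W₁ W₂ W₃ : Fin n → Fin n → Fin n → ℕ
      I₁ a b d = [ a <ᵇ d ] * ([ b <ᵇ d ] * (A a d * (edeg G a b * edeg G a d)))
      I₂ a b d = [ b <ᵇ d ] * (A b d * (edeg G a b * edeg G b d))
      I₃ a b c = [ a <ᵇ c ] * ([ c <ᵇ b ] * (A c b * (edeg G a b * edeg G c b)))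
      W₁ a b x = [ a <ᵇ b ] * (A a b * I₁ a b x)
      W₂ a b x = [ a <ᵇ b ] * (A a b * I₂ a b x)
      W₃ a b x = [ a <ᵇ b ] * (A a b * I₃ a b x)
      pull-in : ∀ t x (f : Fin n → ℕ) → t * (x * Σv f) ≡ Σv (λ y → t * (x * f y))
      pull-in t x f = trans (cong (t *_) (*-distribˡ-Σv x f)) (*-distribˡ-Σv t (λ y → x * f y))
      distribute : ∀ a b → [ a <ᵇ b ] * (A a b * (Σv (I₁ a b) + Σv (I₂ a b) + Σv (I₃ a b)))
                           ≡ Σv (W₁ a b) + Σv (W₂ a b) + Σv (W₃ a b)
      distribute a b = trans (split3 [ a <ᵇ b ] (A a b) (Σv (I₁ a b)) (Σv (I₂ a b)) (Σv (I₃ a b)))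
        (cong₂ _+_ (cong₂ _+_ (pull-in [ a <ᵇ b ] (A a b) (I₁ a b)) (pull-in [ a <ᵇ b ] (A a b) (I₂ a b)))
                   (pull-in [ a <ᵇ b ] (A a b) (I₃ a b)))
        where
        split3 : ∀ t x i j k → t * (x * (i + j + k)) ≡ t * (x * i) + t * (x * j) + t * (x * k)
        split3 = solve-∀

    counting-identity : 2 * EM2 G + 12 * M2 G + 5 * M1 G 3 + 8 * numEdges G
                      ≡ 2 * Θ2 G + 2 * α12 G + 12 * M1 G 2 + M1 G 4
    counting-identity = begin
      2 * EM2 G + 12 * M2 G + 5 * M1 G 3 + 8 * numEdges G
        ≡⟨ cong₂ (λ s t → 2 * EM2 G + s + 5 * M1 G 3 + t) (*-assoc 6 2 (M2 G)) (*-assoc 4 2 (numEdges G)) ⟩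
      2 * EM2 G + 6 * (2 * M2 G) + 5 * M1 G 3 + 4 * (2 * numEdges G)
        ≡⟨ cong₂ _+_ (cong₂ _+_ (cong₂ _+_ (Σv-scale 2 X (sym EM2≡Σv-pairSum)) (Σv-scale 6 (λ v → x v * S v) Σv-deg*nbrDeg))
                               (Σv-scale 5 (λ v → x v * (x v * x v)) Σv-deg³))
                     (Σv-scale 4 x Σv-deg) ⟨
      Σv (λ v → 2 * X v) + Σv (λ v → 6 * (x v * S v)) + Σv (λ v → 5 * (x v * (x v * x v))) + Σv (λ v → 4 * x v)
        ≡⟨ Σv-+₄ (λ v → 2 * X v) (λ v → 6 * (x v * S v)) (λ v → 5 * (x v * (x v * x v))) (λ v → 4 * x v) ⟨
      Σv (λ v → 2 * X v + 6 * (x v * S v) + 5 * (x v * (x v * x v)) + 4 * x v)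
        ≡⟨ Σv-cong vertex-identity-at ⟩
      Σv (λ v → 2 * Y v + 2 * (x v * x v * S v) + 4 * S v + x v * x v * (x v * x v) + 8 * (x v * x v))
        ≡⟨ Σv-+₅ (λ v → 2 * Y v) (λ v → 2 * (x v * x v * S v)) (λ v → 4 * S v)
                 (λ v → x v * x v * (x v * x v)) (λ v → 8 * (x v * x v)) ⟩
      Σv (λ v → 2 * Y v) + Σv (λ v → 2 * (x v * x v * S v)) + Σv (λ v → 4 * S v)
        + Σv (λ v → x v * x v * (x v * x v)) + Σv (λ v → 8 * (x v * x v))
        ≡⟨ cong₂ _+_ (cong₂ _+_ (cong₂ _+_ (cong₂ _+_ (Σv-scale 2 Y (sym Θ2≡Σv-pairSum))
                                                     (Σv-scale 2 (λ v → x v * x v * S v) Σv-deg²*nbrDeg))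
                                           (Σv-scale 4 S Σv-nbrDeg))
                               Σv-deg⁴)
                     (Σv-scale 8 (λ v → x v * x v) Σv-deg²) ⟩
      2 * Θ2 G + 2 * α12 G + 4 * M1 G 2 + M1 G 4 + 8 * M1 G 2
        ≡⟨ collect (2 * Θ2 G + 2 * α12 G) (M1 G 2) (M1 G 4) ⟩
      2 * Θ2 G + 2 * α12 G + 12 * M1 G 2 + M1 G 4 ∎
      where
      open ≡-Reasoning
      collect : ∀ a b c → a + 4 * b + c + 8 * b ≡ a + 12 * b + c
      collect = solve-∀
      x S X Y : Fin n → ℕ
      x v = deg G v
      S v = Σv (nbrDeg v)
      X v = pairSum (nbrEdeg v)
      Y v = pairSum (nbrDeg v)

open Counting using (counting-identity)

open import Data.Nat as ℕ using (ℕ)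
import Data.Integer as ℤ
import Data.Integer.Properties as ℤ
open import Data.Rational using (ℚ; _+_; _-_; _*_; ½; toℚᵘ)
open import Data.Rational.Properties using (toℚᵘ-injective; toℚᵘ-fromℚᵘ; toℚᵘ-homo-+; toℚᵘ-homo-*)
open import Data.Rational.Unnormalised as ℚᵘ using (mkℚᵘ; *≡*)
open import Data.Rational.Unnormalised.Properties using (≃-trans; ≃-sym; +-cong; *-cong)
open import Data.Rational.Solver using (module +-*-Solver)
open import Relation.Binary.PropositionalEquality using (_≡_; refl; sym; trans; cong; cong₂; module ≡-Reasoning)

toℚᵘ-ℚ[] : ∀ k → toℚᵘ ℚ[ k ] ℚᵘ.≃ mkℚᵘ (ℤ.+ k) 0
toℚᵘ-ℚ[] k = toℚᵘ-fromℚᵘ (mkℚᵘ (ℤ.+ k) 0)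

ℚ[]-+ : ∀ a b → ℚ[ a ℕ.+ b ] ≡ ℚ[ a ] + ℚ[ b ]
ℚ[]-+ a b = toℚᵘ-injective (≃-trans (toℚᵘ-ℚ[] (a ℕ.+ b)) (≃-sym (≃-trans (toℚᵘ-homo-+ ℚ[ a ] ℚ[ b ])
  (≃-trans (+-cong (toℚᵘ-ℚ[] a) (toℚᵘ-ℚ[] b))
    (*≡* (cong (ℤ._* ℤ.+ 1) (cong₂ ℤ._+_ (ℤ.*-identityʳ (ℤ.+ a)) (ℤ.*-identityʳ (ℤ.+ b)))))))))

ℚ[]-* : ∀ a b → ℚ[ a ℕ.* b ] ≡ ℚ[ a ] * ℚ[ b ]
ℚ[]-* a b = toℚᵘ-injective (≃-trans (toℚᵘ-ℚ[] (a ℕ.* b)) (≃-sym (≃-trans (toℚᵘ-homo-* ℚ[ a ] ℚ[ b ])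
  (≃-trans (*-cong (toℚᵘ-ℚ[] a) (toℚᵘ-ℚ[] b)) (*≡* (cong (ℤ._* ℤ.+ 1) (sym (ℤ.pos-* a b))))))))

ℚ[]-+₄ : ∀ a b c d → ℚ[ a ℕ.+ b ℕ.+ c ℕ.+ d ] ≡ ℚ[ a ] + ℚ[ b ] + ℚ[ c ] + ℚ[ d ]
ℚ[]-+₄ a b c d = trans (ℚ[]-+ (a ℕ.+ b ℕ.+ c) d)
  (cong (_+ ℚ[ d ]) (trans (ℚ[]-+ (a ℕ.+ b) c) (cong (_+ ℚ[ c ]) (ℚ[]-+ a b))))

halve-identity : ∀ (e α M m4 m3 m2 m θ : ℕ) →
  2 ℕ.* e ℕ.+ 12 ℕ.* M ℕ.+ 5 ℕ.* m3 ℕ.+ 8 ℕ.* m ≡ 2 ℕ.* θ ℕ.+ 2 ℕ.* α ℕ.+ 12 ℕ.* m2 ℕ.+ m4 →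
  ℚ[ e ] ≡ ℚ[ α ] - ℚ[ 6 ] * ℚ[ M ] + ½ * ℚ[ m4 ] - ℚ[ 5 ] * ½ * ℚ[ m3 ] + ℚ[ 6 ] * ℚ[ m2 ] - ℚ[ 4 ] * ℚ[ m ] + ℚ[ θ ]
halve-identity e α M m4 m3 m2 m θ eq = begin
  E                  ≡⟨ solve 2 (λ E L → E := E :+ con ½ :* (L :- L)) refl E L ⟩
  E + ½ * (L - L)    ≡⟨ cong (λ t → E + ½ * (t - L)) cast ⟩
  E + ½ * (R - L)    ≡⟨ solve 8 (λ E A M M₄ M₃ M₂ m θ →
                          E :+ con ½ :* ((con ℚ[ 2 ] :* θ :+ con ℚ[ 2 ] :* A :+ con ℚ[ 12 ] :* M₂ :+ M₄)
                                         :- (con ℚ[ 2 ] :* E :+ con ℚ[ 12 ] :* M :+ con ℚ[ 5 ] :* M₃ :+ con ℚ[ 8 ] :* m))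
                          := A :- con ℚ[ 6 ] :* M :+ con ½ :* M₄ :- con ℚ[ 5 ] :* con ½ :* M₃ :+ con ℚ[ 6 ] :* M₂
                             :- con ℚ[ 4 ] :* m :+ θ)
                        refl E ℚ[ α ] ℚ[ M ] ℚ[ m4 ] ℚ[ m3 ] ℚ[ m2 ] ℚ[ m ] ℚ[ θ ] ⟩
  ℚ[ α ] - ℚ[ 6 ] * ℚ[ M ] + ½ * ℚ[ m4 ] - ℚ[ 5 ] * ½ * ℚ[ m3 ] + ℚ[ 6 ] * ℚ[ m2 ] - ℚ[ 4 ] * ℚ[ m ] + ℚ[ θ ] ∎
  where
  open ≡-Reasoning
  open +-*-Solver
  E = ℚ[ e ]
  L = ℚ[ 2 ] * E + ℚ[ 12 ] * ℚ[ M ] + ℚ[ 5 ] * ℚ[ m3 ] + ℚ[ 8 ] * ℚ[ m ]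
  R = ℚ[ 2 ] * ℚ[ θ ] + ℚ[ 2 ] * ℚ[ α ] + ℚ[ 12 ] * ℚ[ m2 ] + ℚ[ m4 ]
  cast : L ≡ R
  cast = begin
    L   ≡⟨ cong₂ _+_ (cong₂ _+_ (cong₂ _+_ (ℚ[]-* 2 e) (ℚ[]-* 12 M)) (ℚ[]-* 5 m3)) (ℚ[]-* 8 m) ⟨
    ℚ[ 2 ℕ.* e ] + ℚ[ 12 ℕ.* M ] + ℚ[ 5 ℕ.* m3 ] + ℚ[ 8 ℕ.* m ]
        ≡⟨ ℚ[]-+₄ (2 ℕ.* e) (12 ℕ.* M) (5 ℕ.* m3) (8 ℕ.* m) ⟨
    ℚ[ 2 ℕ.* e ℕ.+ 12 ℕ.* M ℕ.+ 5 ℕ.* m3 ℕ.+ 8 ℕ.* m ]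
        ≡⟨ cong ℚ[_] eq ⟩
    ℚ[ 2 ℕ.* θ ℕ.+ 2 ℕ.* α ℕ.+ 12 ℕ.* m2 ℕ.+ m4 ]
        ≡⟨ ℚ[]-+₄ (2 ℕ.* θ) (2 ℕ.* α) (12 ℕ.* m2) m4 ⟩
    ℚ[ 2 ℕ.* θ ] + ℚ[ 2 ℕ.* α ] + ℚ[ 12 ℕ.* m2 ] + ℚ[ m4 ]
        ≡⟨ cong₂ _+_ (cong₂ _+_ (cong₂ _+_ (ℚ[]-* 2 θ) (ℚ[]-* 2 α)) (ℚ[]-* 12 m2)) refl ⟩
    R   ∎

lemma2p14 : ∀ (n : ℕ) (G : Graph n) →
    ℚ[ EM2 G ] ≡
      ℚ[ α12 G ] - ℚ[ 6 ] * ℚ[ M2 G ] + ½ * ℚ[ M1 G 4 ]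
        - ℚ[ 5 ] * ½ * ℚ[ M1 G 3 ] + ℚ[ 6 ] * ℚ[ M1 G 2 ]
        - ℚ[ 4 ] * ℚ[ numEdges G ] + ℚ[ Θ2 G ]
lemma2p14 n G =
  halve-identity (EM2 G) (α12 G) (M2 G) (M1 G 4) (M1 G 3) (M1 G 2) (numEdges G) (Θ2 G) (counting-identity G)
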